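{- Let $A$ be an $n\times n\times n$ integer hypermatrix. Then $A$ is an alternating sign hypermatrix if and only if $\Xi(A)$ is a corner-sum hypermatrix of order $n$ and, for all $i,j,k\in[n]$, \begin{align*} \Xi(A)_{i,j,k}-\Xi(A)_{i-1,j,k}-\Xi(A)_{i,j-1,k}+\Xi(A)_{i-1,j-1,k}&\in\{0,1\},\\ \Xi(A)_{i,j,k}-\Xi(A)_{i-1,j,k}-\Xi(A)_{i,j,k-1}+\Xi(A)_{i-1,j,k-1}&\in\{0,1\},\\ \Xi(A)_{i,j,k}-\Xi(A)_{i,j-1,k}-\Xi(A)_{i,j,k-1}+\Xi(A)_{i,j-1,k-1}&\in\{0,1\}. \end{align*}
   Context: An alternating sign hypermatrix of order $n$ is an $n\times n\times n$ array with entries in $\{0,1,-1\}$ such that in each line (fixing two of the three indices) the nonzero entries alternate in sign, starting and ending with $+1$. $\Xi(A)_{i,j,k}=\sum_{a=1}^i\sum_{b=1}^j\sum_{c=1}^k A_{a,b,c}$ for $i,j,k\in[0,n]$. A corner-sum hypermatrix of order $n$ is an integer array $C$ indexed by $[0,n]^3$ with $C_{i,j,0}=C_{i,0,j}=C_{0,i,j}=0$, $C_{i,j,n}=C_{i,n,j}=C_{n,i,j}=ij$ for all $i,j\in[0,n]$, and for all $i,j\in[0,n]$, $1\le k\le n$, each of $C_{i,j,k}-C_{i,j,k-1}$, $C_{i,k,j}-C_{i,k-1,j}$, $C_{k,i,j}-C_{k-1,i,j}$ in $\{\max(0,i+j-n),\dots,\min(i,j)\}$. -}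

module Defs where

open import Data.Nat as ℕ using (ℕ; zero; suc; _∸_; _⊓_; _<?_)
open import Data.Fin using (Fin; fromℕ<)
open import Data.Integer as ℤ using (ℤ; +_; -[1+_]; _-_; _≤_)
open import Data.List using (List; []; _∷_; tabulate)
open import Data.Sum using (_⊎_)
open import Data.Product using (_×_)
open import Relation.Binary.PropositionalEquality using (_≡_)
open import Relation.Nullary using (yes; no)

-- An n×n×n integer hypermatrix; entry A a b c with a b c : Fin n
-- corresponds to the paper's A_{a+1,b+1,c+1} (paper indices are 1-based).
Hypermatrix : ℕ → Set
Hypermatrix n = Fin n → Fin n → Fin n → ℤ

Sign : ℤ → Set
Sign x = (x ≡ + 0) ⊎ (x ≡ + 1) ⊎ (x ≡ -[1+ 0 ])

nonzeros : List ℤ → List ℤ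
nonzeros [] = []
nonzeros (+ zero ∷ xs) = nonzeros xs
nonzeros (x ∷ xs) = x ∷ nonzeros xs

data Alternating : List ℤ → Set where
  alt-one  : Alternating (+ 1 ∷ [])
  alt-cons : ∀ {xs} → Alternating xs → Alternating (+ 1 ∷ -[1+ 0 ] ∷ xs)

AltLine : List ℤ → Set
AltLine xs = Alternating (nonzeros xs)

IsASHM : (n : ℕ) → Hypermatrix n → Set
IsASHM n A =
  (∀ a b c → Sign (A a b c)) ×
  (∀ b c → AltLine (tabulate (λ a → A a b c))) ×
  (∀ a c → AltLine (tabulate (λ b → A a b c))) ×
  (∀ a b → AltLine (tabulate (λ c → A a b c)))

-- 1-based access to a Fin-indexed vector; 0 outside [1,n].
at : {n : ℕ} → (Fin n → ℤ) → ℕ → ℤ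
at f zero = + 0
at {n} f (suc a) with a <? n
... | yes p = f (fromℕ< p)
... | no _  = + 0

sumTo : ℕ → (ℕ → ℤ) → ℤ
sumTo zero f = + 0
sumTo (suc m) f = sumTo m f ℤ.+ f (suc m)

-- Ξ(A)_{i,j,k} = Σ_{a=1}^i Σ_{b=1}^j Σ_{c=1}^k A_{a,b,c}  (used for i,j,k ∈ [0,n])
Ξ : {n : ℕ} → Hypermatrix n → ℕ → ℕ → ℕ → ℤ
Ξ A i j k = sumTo i (λ a → sumTo j (λ b → sumTo k (λ c →
  at (λ z → at (λ y → at (λ x → A x y z) a) b) c)))

InRange : ℕ → ℕ → ℕ → ℤ → Set
InRange n i j d = (+ ((i ℕ.+ j) ∸ n) ≤ d) × (d ≤ + (i ⊓ j))

-- Corner-sum hypermatrix of order n (indexed by [0,n]^3; values outside are irrelevant).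
IsCornerSum : (n : ℕ) → (ℕ → ℕ → ℕ → ℤ) → Set
IsCornerSum n C =
  (∀ i j → i ℕ.≤ n → j ℕ.≤ n →
     (C i j 0 ≡ + 0) × (C i 0 j ≡ + 0) × (C 0 i j ≡ + 0) ×
     (C i j n ≡ + (i ℕ.* j)) × (C i n j ≡ + (i ℕ.* j)) × (C n i j ≡ + (i ℕ.* j))) ×
  (∀ i j k → i ℕ.≤ n → j ℕ.≤ n → 1 ℕ.≤ k → k ℕ.≤ n →
     InRange n i j (C i j k - C i j (k ∸ 1)) ×
     InRange n i j (C i k j - C i (k ∸ 1) j) ×
     InRange n i j (C k i j - C (k ∸ 1) i j))

ZeroOne : ℤ → Set
ZeroOne x = (x ≡ + 0) ⊎ (x ≡ + 1)

-- A line is alternating iff its prefix sums lie in {0,1} and the last one is 1. The mixed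
-- second differences of Ξ(A) are prefix sums along lines of A, so they lie in {0,1};
-- conversely they recover these prefix sums, and the corner values Ξ = i·j make every full
-- line sum 1. The first differences of Ξ(A) are corner sums S over [1,i]×[1,j] of planar
-- slices of A, whose rows and columns are alternating; hence 0 ≤ S ≤ min(i,j), and
-- i = S + (entries of the columns j+1, …, n in the rows 1, …, i) ≤ S + (n − j).
-- Rotating the axes reduces every direction to the first one.
module Submission where

open import Data.Nat as ℕ using (ℕ; zero; suc; _≤_; _∸_; z≤n; s≤s)
import Data.Nat.Properties as ℕP
open import Data.Fin using (Fin; toℕ; fromℕ<) renaming (zero to fzero; suc to fsuc)
import Data.Fin.Properties as FinP
open import Data.Integer as ℤ using (ℤ; +_; -[1+_]; _+_; _-_; _*_; +≤+)
import Data.Integer.Properties as ℤP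
open import Data.Integer.Tactic.RingSolver using (solve-∀)
open import Data.List using (List; []; _∷_; tabulate)
open import Data.Product using (_×_; _,_; proj₁; proj₂)
open import Data.Sum using (inj₁; inj₂)
open import Data.Empty using (⊥-elim)
open import Function.Bundles using (_⇔_; mk⇔; module Equivalence)
import Function.Properties.Equivalence as ⇔
open import Relation.Nullary using (¬_; yes; no; contradiction)
open import Relation.Binary.PropositionalEquality

open import Defs

OnRange : ℕ → (ℕ → Set) → Set
OnRange m P = ∀ a → 1 ≤ a → a ≤ m → P a

OnRange-mono : ∀ {m p P} → m ≤ p → OnRange p P → OnRange m P
OnRange-mono m≤p h a 1≤a a≤m = h a 1≤a (ℕP.≤-trans a≤m m≤p)

OnRange-last : ∀ {m P} → OnRange (suc m) P → P (suc m)
OnRange-last {m} h = h (suc m) (s≤s z≤n) ℕP.≤-refl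

OnRange⇔∀Fin : ∀ {n} {P : ℕ → Set} → OnRange n P ⇔ (∀ (i : Fin n) → P (suc (toℕ i)))
OnRange⇔∀Fin {n} {P} = mk⇔
  (λ h i → h (suc (toℕ i)) (s≤s z≤n) (FinP.toℕ<n i))
  (λ { h (suc a) _ a<n → subst P (cong suc (FinP.toℕ-fromℕ< a<n)) (h (fromℕ< a<n)) })

sumTo-cong : ∀ m {f g : ℕ → ℤ} → (∀ a → f a ≡ g a) → sumTo m f ≡ sumTo m g
sumTo-cong zero    eq = refl
sumTo-cong (suc m) eq = cong₂ _+_ (sumTo-cong m eq) (eq (suc m))

sumTo-zero : ∀ m → sumTo m (λ _ → + 0) ≡ + 0
sumTo-zero zero    = refl
sumTo-zero (suc m) = cong (_+ + 0) (sumTo-zero m)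

sumTo-+ : ∀ m (f g : ℕ → ℤ) → sumTo m (λ a → f a + g a) ≡ sumTo m f + sumTo m g
sumTo-+ zero    f g = refl
sumTo-+ (suc m) f g =
  trans (cong (_+ (f (suc m) + g (suc m))) (sumTo-+ m f g))
        (interchange (sumTo m f) (sumTo m g) (f (suc m)) (g (suc m)))
  where
  interchange : ∀ x y u v → (x + y) + (u + v) ≡ (x + u) + (y + v)
  interchange = solve-∀

sumTo-comm : ∀ m p (h : ℕ → ℕ → ℤ) →
  sumTo m (λ a → sumTo p (h a)) ≡ sumTo p (λ b → sumTo m (λ a → h a b))
sumTo-comm zero    p h = sym (sumTo-zero p)
sumTo-comm (suc m) p h =
  trans (cong (_+ sumTo p (h (suc m))) (sumTo-comm m p h))
        (sym (sumTo-+ p (λ b → sumTo m (λ a → h a b)) (h (suc m))))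

sumTo-suc-diff : ∀ m (f : ℕ → ℤ) → sumTo (suc m) f - sumTo m f ≡ f (suc m)
sumTo-suc-diff m f = cancel (sumTo m f) (f (suc m))
  where
  cancel : ∀ x u → (x + u) - x ≡ u
  cancel = solve-∀

sumTo-shift : ∀ k (h : ℕ → ℤ) → sumTo (suc k) h ≡ h 1 + sumTo k (λ a → h (suc a))
sumTo-shift zero    h = trans (ℤP.+-identityˡ (h 1)) (sym (ℤP.+-identityʳ (h 1)))
sumTo-shift (suc k) h =
  trans (cong (_+ h (suc (suc k))) (sumTo-shift k h))
        (ℤP.+-assoc (h 1) (sumTo k (λ a → h (suc a))) (h (suc (suc k))))

sumTo-split : ∀ t j (f : ℕ → ℤ) → sumTo (t ℕ.+ j) f ≡ sumTo j f + sumTo t (λ b → f (b ℕ.+ j))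
sumTo-split zero    j f = sym (ℤP.+-identityʳ (sumTo j f))
sumTo-split (suc t) j f =
  trans (cong (_+ f (suc t ℕ.+ j)) (sumTo-split t j f))
        (ℤP.+-assoc (sumTo j f) (sumTo t (λ b → f (b ℕ.+ j))) (f (suc t ℕ.+ j)))

sumTo-const : ∀ m {c} {f : ℕ → ℤ} → OnRange m (λ a → f a ≡ + c) → sumTo m f ≡ + (m ℕ.* c)
sumTo-const zero    _ = refl
sumTo-const (suc m) {c} h =
  trans (cong₂ _+_ (sumTo-const m (OnRange-mono (ℕP.n≤1+n m) h)) (OnRange-last h))
        (trans (sym (ℤP.pos-+ (m ℕ.* c) c)) (cong +_ (ℕP.+-comm (m ℕ.* c) c)))

ZeroOne-bounds : ∀ {x} → ZeroOne x → (+ 0 ℤ.≤ x) × (x ℤ.≤ + 1)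
ZeroOne-bounds (inj₁ refl) = +≤+ z≤n , +≤+ z≤n
ZeroOne-bounds (inj₂ refl) = +≤+ z≤n , ℤP.≤-refl

sumTo-bounds : ∀ m {f : ℕ → ℤ} → OnRange m (λ a → ZeroOne (f a)) →
  (+ 0 ℤ.≤ sumTo m f) × (sumTo m f ℤ.≤ + m)
sumTo-bounds zero    _ = ℤP.≤-refl , ℤP.≤-refl
sumTo-bounds (suc m) h with sumTo-bounds m (OnRange-mono (ℕP.n≤1+n m) h)
                          | ZeroOne-bounds (OnRange-last h)
... | 0≤s , s≤m | 0≤x , x≤1 =
  ℤP.+-mono-≤ 0≤s 0≤x ,
  ℤP.≤-trans (ℤP.+-mono-≤ s≤m x≤1) (ℤP.≤-reflexive (cong +_ (ℕP.+-comm m 1)))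

sumTo-≤-prefix : ∀ {p j} {f : ℕ → ℤ} → j ≤ p → OnRange p (λ b → ZeroOne (f b)) →
  sumTo p f ℤ.≤ sumTo j f + + (p ∸ j)
sumTo-≤-prefix {p} {j} {f} j≤p h = begin
  sumTo p f                                         ≡⟨ cong (λ q → sumTo q f) (sym p-j+j≡p) ⟩
  sumTo (p ∸ j ℕ.+ j) f                             ≡⟨ sumTo-split (p ∸ j) j f ⟩
  sumTo j f + sumTo (p ∸ j) (λ b → f (b ℕ.+ j))    ≤⟨ ℤP.+-monoʳ-≤ (sumTo j f) (proj₂ (sumTo-bounds (p ∸ j) rest01)) ⟩
  sumTo j f + + (p ∸ j)                             ∎
  where
  open ℤP.≤-Reasoning
  p-j+j≡p : p ∸ j ℕ.+ j ≡ p
  p-j+j≡p = ℕP.m∸n+n≡m j≤p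
  rest01 : OnRange (p ∸ j) (λ b → ZeroOne (f (b ℕ.+ j)))
  rest01 b 1≤b b≤p-j = h (b ℕ.+ j) (ℕP.≤-trans 1≤b (ℕP.m≤m+n b j))
    (ℕP.≤-trans (ℕP.+-monoˡ-≤ j b≤p-j) (ℕP.≤-reflexive p-j+j≡p))

-- Prefix-sum description of alternating lines

RunningSums01 : ℤ → List ℤ → Set
RunningSums01 s []       = s ≡ + 1
RunningSums01 s (x ∷ xs) = ZeroOne s × RunningSums01 (s + x) xs

RunningSums01-head : ∀ {s} xs → RunningSums01 s xs → ZeroOne s
RunningSums01-head []      r       = inj₂ r
RunningSums01-head (_ ∷ _) (z , _) = z

¬ZeroOne-2+ : ∀ {m} → ¬ ZeroOne (+ suc (suc m))
¬ZeroOne-2+ (inj₁ ())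
¬ZeroOne-2+ (inj₂ ())

¬ZeroOne-neg : ∀ {m} → ¬ ZeroOne -[1+ m ]
¬ZeroOne-neg (inj₁ ())
¬ZeroOne-neg (inj₂ ())

-- Running sum 1 corresponds to a pending +1 in front of the remaining nonzero entries.
alternating⇒runningSums₀ : ∀ xs → Alternating (nonzeros xs) → RunningSums01 (+ 0) xs
alternating⇒runningSums₁ : ∀ xs → Alternating (+ 1 ∷ nonzeros xs) → RunningSums01 (+ 1) xs
alternating⇒runningSums₀ (+ zero ∷ xs)       alt = inj₁ refl , alternating⇒runningSums₀ xs alt
alternating⇒runningSums₀ (+ suc zero ∷ xs)   alt = inj₁ refl , alternating⇒runningSums₁ xs alt
alternating⇒runningSums₀ []                   ()
alternating⇒runningSums₀ (+ suc (suc _) ∷ _) ()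
alternating⇒runningSums₀ (-[1+ _ ] ∷ _)       ()
alternating⇒runningSums₁ []                   alt-one        = refl
alternating⇒runningSums₁ (+ zero ∷ xs)        alt            = inj₂ refl , alternating⇒runningSums₁ xs alt
alternating⇒runningSums₁ (-[1+ zero ] ∷ xs)   (alt-cons alt) = inj₂ refl , alternating⇒runningSums₀ xs alt
alternating⇒runningSums₁ (+ suc _ ∷ _)        ()
alternating⇒runningSums₁ (-[1+ suc _ ] ∷ _)   ()

runningSums₀⇒alternating : ∀ xs → RunningSums01 (+ 0) xs → Alternating (nonzeros xs)
runningSums₁⇒alternating : ∀ xs → RunningSums01 (+ 1) xs → Alternating (+ 1 ∷ nonzeros xs)
runningSums₀⇒alternating []                   ()
runningSums₀⇒alternating (+ zero ∷ xs)        (_ , r) = runningSums₀⇒alternating xs r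
runningSums₀⇒alternating (+ suc zero ∷ xs)    (_ , r) = runningSums₁⇒alternating xs r
runningSums₀⇒alternating (+ suc (suc _) ∷ xs) (_ , r) = ⊥-elim (¬ZeroOne-2+ (RunningSums01-head xs r))
runningSums₀⇒alternating (-[1+ _ ] ∷ xs)      (_ , r) = ⊥-elim (¬ZeroOne-neg (RunningSums01-head xs r))
runningSums₁⇒alternating []                   _       = alt-one
runningSums₁⇒alternating (+ zero ∷ xs)        (_ , r) = runningSums₁⇒alternating xs r
runningSums₁⇒alternating (-[1+ zero ] ∷ xs)   (_ , r) = alt-cons (runningSums₀⇒alternating xs r)
runningSums₁⇒alternating (+ suc _ ∷ xs)       (_ , r) = ⊥-elim (¬ZeroOne-2+ (RunningSums01-head xs r))
runningSums₁⇒alternating (-[1+ suc _ ] ∷ xs)  (_ , r) = ⊥-elim (¬ZeroOne-neg (RunningSums01-head xs r))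

AltLine⇔RunningSums01 : ∀ xs → AltLine xs ⇔ RunningSums01 (+ 0) xs
AltLine⇔RunningSums01 xs = mk⇔ (alternating⇒runningSums₀ xs) (runningSums₀⇒alternating xs)

AltSigns : ℕ → (ℕ → ℤ) → Set
AltSigns n h = (∀ k → k ≤ n → ZeroOne (sumTo k h)) × (sumTo n h ≡ + 1)

AltSignsFrom : ℤ → ℕ → (ℕ → ℤ) → Set
AltSignsFrom s n h = (∀ k → k ≤ n → ZeroOne (s + sumTo k h)) × (s + sumTo n h ≡ + 1)

RunningSums01-tabulate : ∀ {n} (f : Fin n → ℤ) (h : ℕ → ℤ) → (∀ i → h (suc (toℕ i)) ≡ f i) →
  ∀ s → RunningSums01 s (tabulate f) ⇔ AltSignsFrom s n h
RunningSums01-tabulate {zero} f h _ s = mk⇔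
  (λ r → (λ { zero z≤n → subst ZeroOne (sym (ℤP.+-identityʳ s)) (inj₂ r) }) ,
         trans (ℤP.+-identityʳ s) r)
  (λ (_ , total) → trans (sym (ℤP.+-identityʳ s)) total)
RunningSums01-tabulate {suc m} f h agree s = mk⇔
  (λ (z , r) → let (prefix01 , total) = Equivalence.to rest r in
     (λ { zero _ → subst ZeroOne (sym (ℤP.+-identityʳ s)) z
        ; (suc k) (s≤s k≤m) → subst ZeroOne (sym (shift k)) (prefix01 k k≤m) }) ,
     trans (shift m) total)
  (λ (prefix01 , total) →
     subst ZeroOne (ℤP.+-identityʳ s) (prefix01 0 z≤n) ,
     Equivalence.from rest
       ((λ k k≤m → subst ZeroOne (shift k) (prefix01 (suc k) (s≤s k≤m))) ,
        trans (sym (shift m)) total))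
  where
  rest : RunningSums01 (s + f fzero) (tabulate (λ i → f (fsuc i))) ⇔ AltSignsFrom (s + f fzero) m (λ a → h (suc a))
  rest = RunningSums01-tabulate (λ i → f (fsuc i)) (λ a → h (suc a)) (λ i → agree (fsuc i)) (s + f fzero)
  shift : ∀ k → s + sumTo (suc k) h ≡ (s + f fzero) + sumTo k (λ a → h (suc a))
  shift k = trans (cong (λ e → s + e) (trans (sumTo-shift k h) (cong (_+ _) (agree fzero))))
                  (sym (ℤP.+-assoc s (f fzero) _))

AltSignsFrom0⇔AltSigns : ∀ {n h} → AltSignsFrom (+ 0) n h ⇔ AltSigns n h
AltSignsFrom0⇔AltSigns = mk⇔
  (λ (prefix01 , total) → (λ k k≤n → subst ZeroOne (ℤP.+-identityˡ _) (prefix01 k k≤n)) ,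
                           trans (sym (ℤP.+-identityˡ _)) total)
  (λ (prefix01 , total) → (λ k k≤n → subst ZeroOne (sym (ℤP.+-identityˡ _)) (prefix01 k k≤n)) ,
                           trans (ℤP.+-identityˡ _) total)

AltLine⇔AltSigns : ∀ {n} (f : Fin n → ℤ) (h : ℕ → ℤ) → (∀ i → h (suc (toℕ i)) ≡ f i) →
  AltLine (tabulate f) ⇔ AltSigns n h
AltLine⇔AltSigns f h agree =
  ⇔.trans (AltLine⇔RunningSums01 (tabulate f))
    (⇔.trans (RunningSums01-tabulate f h agree (+ 0)) AltSignsFrom0⇔AltSigns)

ZeroOne-diff-Sign : ∀ {p q} → ZeroOne q → ZeroOne p → Sign (q - p)
ZeroOne-diff-Sign (inj₁ refl) (inj₁ refl) = inj₁ refl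
ZeroOne-diff-Sign (inj₁ refl) (inj₂ refl) = inj₂ (inj₂ refl)
ZeroOne-diff-Sign (inj₂ refl) (inj₁ refl) = inj₂ (inj₁ refl)
ZeroOne-diff-Sign (inj₂ refl) (inj₂ refl) = inj₁ refl

AltSigns-Sign : ∀ {n h} → AltSigns n h → ∀ (i : Fin n) → Sign (h (suc (toℕ i)))
AltSigns-Sign {h = h} (prefix01 , _) i =
  subst Sign (sumTo-suc-diff (toℕ i) h)
    (ZeroOne-diff-Sign (prefix01 (suc (toℕ i)) (FinP.toℕ<n i))
                       (prefix01 (toℕ i) (ℕP.<⇒≤ (FinP.toℕ<n i))))

-- Alternating sign matrices and their corner sums

sumTo² : (ℕ → ℕ → ℤ) → ℕ → ℕ → ℤ
sumTo² G i j = sumTo i (λ a → sumTo j (G a))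

sumTo²-mixedDiff : ∀ (G : ℕ → ℕ → ℤ) i j →
  sumTo² G (suc i) (suc j) - sumTo² G i (suc j) - sumTo² G (suc i) j + sumTo² G i j ≡ G (suc i) (suc j)
sumTo²-mixedDiff G i j = begin
  S (suc i) (suc j) - S i (suc j) - S (suc i) j + S i j     ≡⟨ regroup (S (suc i) (suc j)) (S i (suc j)) (S (suc i) j) (S i j) ⟩
  (S (suc i) (suc j) - S i (suc j)) - (S (suc i) j - S i j) ≡⟨ cong₂ _-_ (sumTo-suc-diff i _) (sumTo-suc-diff i _) ⟩
  sumTo (suc j) (G (suc i)) - sumTo j (G (suc i))           ≡⟨ sumTo-suc-diff j (G (suc i)) ⟩
  G (suc i) (suc j)                                         ∎
  where
  open ≡-Reasoning
  S : ℕ → ℕ → ℤ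
  S = sumTo² G
  regroup : ∀ x y z w → x - y - z + w ≡ (x - y) - (z - w)
  regroup = solve-∀

ASM : ℕ → (ℕ → ℕ → ℤ) → Set
ASM n G = OnRange n (λ a → AltSigns n (G a)) × OnRange n (λ b → AltSigns n (λ a → G a b))

i≤d+[n∸j]⇒[i+j]∸n≤d : ∀ {i j n} d → j ≤ n → + 0 ℤ.≤ d → + i ℤ.≤ d + + (n ∸ j) →
  + ((i ℕ.+ j) ∸ n) ℤ.≤ d
i≤d+[n∸j]⇒[i+j]∸n≤d {i} {j} {n} (+ m) j≤n _ (+≤+ i≤m+[n∸j]) =
  +≤+ (ℕP.m≤n+o⇒m∸n≤o (i ℕ.+ j) n (begin
    i ℕ.+ j               ≤⟨ ℕP.+-monoˡ-≤ j i≤m+[n∸j] ⟩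
    m ℕ.+ (n ∸ j) ℕ.+ j   ≡⟨ ℕP.+-assoc m (n ∸ j) j ⟩
    m ℕ.+ (n ∸ j ℕ.+ j)   ≡⟨ cong (m ℕ.+_) (ℕP.m∸n+n≡m j≤n) ⟩
    m ℕ.+ n               ≡⟨ ℕP.+-comm m n ⟩
    n ℕ.+ m               ∎))
  where open ℕP.≤-Reasoning

ASM-InRange : ∀ {n} (G : ℕ → ℕ → ℤ) → ASM n G → ∀ {i j} → i ≤ n → j ≤ n →
  InRange n i j (sumTo² G i j)
ASM-InRange {n} G (rows , cols) {i} {j} i≤n j≤n =
  i≤d+[n∸j]⇒[i+j]∸n≤d (sumTo² G i j) j≤n (proj₁ rowBounds) i≤S+[n∸j] ,
  ℤP.⊓-glb (proj₂ rowBounds) S≤j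
  where
  col : ℕ → ℤ
  col b = sumTo i (λ a → G a b)
  S≡colSums : sumTo² G i j ≡ sumTo j col
  S≡colSums = sumTo-comm i j G
  col01 : OnRange n (λ b → ZeroOne (col b))
  col01 b 1≤b b≤n = proj₁ (cols b 1≤b b≤n) i i≤n
  rowBounds : (+ 0 ℤ.≤ sumTo² G i j) × (sumTo² G i j ℤ.≤ + i)
  rowBounds = sumTo-bounds i (λ a 1≤a a≤i → proj₁ (rows a 1≤a (ℕP.≤-trans a≤i i≤n)) j j≤n)
  S≤j : sumTo² G i j ℤ.≤ + j
  S≤j = subst (ℤ._≤ + j) (sym S≡colSums) (proj₂ (sumTo-bounds j (OnRange-mono j≤n col01)))
  allColSums : sumTo n col ≡ + i
  allColSums = trans (sym (sumTo-comm i n G))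
    (trans (sumTo-const i (OnRange-mono i≤n (λ a 1≤a a≤n → proj₂ (rows a 1≤a a≤n))))
           (cong +_ (ℕP.*-identityʳ i)))
  i≤S+[n∸j] : + i ℤ.≤ sumTo² G i j + + (n ∸ j)
  i≤S+[n∸j] = subst₂ (λ l r → l ℤ.≤ r + + (n ∸ j)) allColSums (sym S≡colSums)
                (sumTo-≤-prefix j≤n col01)

InRange-comm : ∀ {n i j d} → InRange n j i d → InRange n i j d
InRange-comm {n} {i} {j} {d} (lower , upper) =
  subst (λ s → + (s ∸ n) ℤ.≤ d) (ℕP.+-comm j i) lower ,
  subst (λ s → d ℤ.≤ + s) (ℕP.⊓-comm j i) upper

-- Corner sums of three-dimensional arrays

cornerSums : (ℕ → ℕ → ℕ → ℤ) → ℕ → ℕ → ℕ → ℤ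
cornerSums E i j k = sumTo i (λ a → sumTo j (λ b → sumTo k (λ c → E a b c)))

rotate : {A : Set} → (ℕ → ℕ → ℕ → A) → ℕ → ℕ → ℕ → A
rotate F x y z = F y z x

cornerSums-rotate : ∀ E x y z → cornerSums (rotate E) x y z ≡ cornerSums E y z x
cornerSums-rotate E x y z = sym (trans
  (sumTo-cong y (λ a → sumTo-comm z x (λ b c → E a b c)))
  (sumTo-comm y x (λ a c → sumTo z (λ b → E a b c))))

cornerSums-rotate² : ∀ E x y z → cornerSums (rotate (rotate E)) x y z ≡ cornerSums E z x y
cornerSums-rotate² E x y z = trans (cornerSums-rotate (rotate E) x y z) (cornerSums-rotate E y z x)

Δ₁ : (ℕ → ℕ → ℕ → ℤ) → ℕ → ℕ → ℕ → ℤ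
Δ₁ C i j k = C i j k - C (i ∸ 1) j k

Δ₁₂ : (ℕ → ℕ → ℕ → ℤ) → ℕ → ℕ → ℕ → ℤ
Δ₁₂ C i j k = C i j k - C (i ∸ 1) j k - C i (j ∸ 1) k + C (i ∸ 1) (j ∸ 1) k

Δ₁-cong : ∀ {C D} → (∀ x y z → C x y z ≡ D x y z) → ∀ i j k → Δ₁ C i j k ≡ Δ₁ D i j k
Δ₁-cong eq i j k = cong₂ _-_ (eq i j k) (eq (i ∸ 1) j k)

Δ₁₂-cong : ∀ {C D} → (∀ x y z → C x y z ≡ D x y z) → ∀ i j k → Δ₁₂ C i j k ≡ Δ₁₂ D i j k
Δ₁₂-cong eq i j k =
  cong₂ _+_ (cong₂ _-_ (cong₂ _-_ (eq i j k) (eq (i ∸ 1) j k)) (eq i (j ∸ 1) k))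
            (eq (i ∸ 1) (j ∸ 1) k)

Δ₁₂-rotate : ∀ C i j k →
  Δ₁₂ (rotate C) k i j ≡ C i j k - C (i ∸ 1) j k - C i j (k ∸ 1) + C (i ∸ 1) j (k ∸ 1)
Δ₁₂-rotate C i j k = swap-middle (C i j k) (C i j (k ∸ 1)) (C (i ∸ 1) j k) (C (i ∸ 1) j (k ∸ 1))
  where
  swap-middle : ∀ x y z w → x - y - z + w ≡ x - z - y + w
  swap-middle = solve-∀

Lines : ℕ → (ℕ → ℕ → ℕ → ℤ) → Set
Lines n F = OnRange n (λ a → OnRange n (λ b → AltSigns n (F a b)))

Lines⇔∀Fin : ∀ {n F} → Lines n F ⇔ (∀ (a b : Fin n) → AltSigns n (F (suc (toℕ a)) (suc (toℕ b))))
Lines⇔∀Fin = mk⇔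
  (λ L a b → Equivalence.to OnRange⇔∀Fin (Equivalence.to OnRange⇔∀Fin L a) b)
  (λ L → Equivalence.from OnRange⇔∀Fin (λ a → Equivalence.from OnRange⇔∀Fin (L a)))

cornerSums-top : ∀ {n F} → Lines n F → ∀ {i j} → i ≤ n → j ≤ n → cornerSums F i j n ≡ + (i ℕ.* j)
cornerSums-top L {i} {j} i≤n j≤n = sumTo-const i (λ a 1≤a a≤i →
  trans (sumTo-const j (λ b 1≤b b≤j → proj₂ (L a 1≤a (ℕP.≤-trans a≤i i≤n) b 1≤b (ℕP.≤-trans b≤j j≤n))))
        (cong +_ (ℕP.*-identityʳ j)))

-- the slice of F at a fixed first index is an ASM, by the lines of F and of rotate F
cornerSums-Δ₁-InRange : ∀ {n F} → Lines n F → Lines n (rotate F) →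
  ∀ {i j k} → i ≤ n → j ≤ n → 1 ≤ k → k ≤ n → InRange n i j (Δ₁ (cornerSums F) k i j)
cornerSums-Δ₁-InRange {n} {F} L L′ {i} {j} {suc k} i≤n j≤n 1≤k k≤n =
  subst (InRange n i j) (sym (sumTo-suc-diff k (λ a → sumTo² (F a) i j)))
    (ASM-InRange (F (suc k)) (L (suc k) 1≤k k≤n , λ c 1≤c c≤n → L′ c 1≤c c≤n (suc k) 1≤k k≤n) i≤n j≤n)

cornerSums-Δ₁₂-01 : ∀ {n F} → Lines n F →
  ∀ {i j k} → 1 ≤ i → i ≤ n → 1 ≤ j → j ≤ n → k ≤ n → ZeroOne (Δ₁₂ (cornerSums F) i j k)
cornerSums-Δ₁₂-01 {F = F} L {suc i} {suc j} {k} 1≤i i≤n 1≤j j≤n k≤n =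
  subst ZeroOne (sym (sumTo²-mixedDiff (λ a b → sumTo k (F a b)) i j))
    (proj₁ (L (suc i) 1≤i i≤n (suc j) 1≤j j≤n) k k≤n)

product-mixedDiff : ∀ a b →
  + (suc a ℕ.* suc b) - + (a ℕ.* suc b) - + (suc a ℕ.* b) + + (a ℕ.* b) ≡ + 1
product-mixedDiff a b
  rewrite ℤP.pos-* (suc a) (suc b) | ℤP.pos-* a (suc b) | ℤP.pos-* (suc a) b | ℤP.pos-* a b =
  expand (+ a) (+ b)
  where
  expand : ∀ x y → (+ 1 + x) * (+ 1 + y) - x * (+ 1 + y) - (+ 1 + x) * y + x * y ≡ + 1
  expand = solve-∀

Lines-from-cornerSums : ∀ {n F} →
  (∀ {i j} → i ≤ n → j ≤ n → cornerSums F i j n ≡ + (i ℕ.* j)) →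
  (∀ {i j k} → 1 ≤ i → i ≤ n → 1 ≤ j → j ≤ n → 1 ≤ k → k ≤ n → ZeroOne (Δ₁₂ (cornerSums F) i j k)) →
  Lines n F
Lines-from-cornerSums {n} {F} top mixed01 (suc a) 1≤a a≤n (suc b) 1≤b b≤n = prefix01 , total
  where
  C : ℕ → ℕ → ℕ → ℤ
  C = cornerSums F
  lineSums : ∀ k → Δ₁₂ C (suc a) (suc b) k ≡ sumTo k (F (suc a) (suc b))
  lineSums k = sumTo²-mixedDiff (λ a b → sumTo k (F a b)) a b
  prefix01 : ∀ k → k ≤ n → ZeroOne (sumTo k (F (suc a) (suc b)))
  prefix01 zero    _   = inj₁ refl
  prefix01 (suc k) k≤n = subst ZeroOne (lineSums (suc k)) (mixed01 1≤a a≤n 1≤b b≤n (s≤s z≤n) k≤n)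
  total : sumTo n (F (suc a) (suc b)) ≡ + 1
  total = begin
    sumTo n (F (suc a) (suc b))                          ≡⟨ sym (lineSums n) ⟩
    C (suc a) (suc b) n - C a (suc b) n - C (suc a) b n + C a b n
      ≡⟨ cong₂ _+_ (cong₂ _-_ (cong₂ _-_ (top a≤n b≤n) (top a≤n′ b≤n)) (top a≤n b≤n′)) (top a≤n′ b≤n′) ⟩
    + (suc a ℕ.* suc b) - + (a ℕ.* suc b) - + (suc a ℕ.* b) + + (a ℕ.* b) ≡⟨ product-mixedDiff a b ⟩
    + 1                                                  ∎
    where
    open ≡-Reasoning
    a≤n′ : a ≤ n
    a≤n′ = ℕP.<⇒≤ a≤n
    b≤n′ : b ≤ n
    b≤n′ = ℕP.<⇒≤ b≤n

-- Alternating sign hypermatrices through their lines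

-- the three families of lines of E, along the third, second and first axis
ASLines : ℕ → (ℕ → ℕ → ℕ → ℤ) → Set
ASLines n E = Lines n E × Lines n (rotate E) × Lines n (rotate (rotate E))

MixedDiffs01 : ℕ → (ℕ → ℕ → ℕ → ℤ) → Set
MixedDiffs01 n C = ∀ i j k → 1 ≤ i → i ≤ n → 1 ≤ j → j ≤ n → 1 ≤ k → k ≤ n →
  ZeroOne (C i j k - C (i ∸ 1) j k - C i (j ∸ 1) k + C (i ∸ 1) (j ∸ 1) k) ×
  ZeroOne (C i j k - C (i ∸ 1) j k - C i j (k ∸ 1) + C (i ∸ 1) j (k ∸ 1)) ×
  ZeroOne (C i j k - C i (j ∸ 1) k - C i j (k ∸ 1) + C i (j ∸ 1) (k ∸ 1))

module _ {n : ℕ} {E : ℕ → ℕ → ℕ → ℤ} where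

  private
    C : ℕ → ℕ → ℕ → ℤ
    C = cornerSums E

  ASLines⇒IsCornerSum : ASLines n E → IsCornerSum n C
  ASLines⇒IsCornerSum (L₁ , L₂ , L₃) =
    (λ i j i≤n j≤n →
      sym (cornerSums-rotate E 0 i j) ,
      sym (cornerSums-rotate² E 0 j i) ,
      refl ,
      cornerSums-top L₁ i≤n j≤n ,
      trans (sym (cornerSums-rotate E j i n)) (trans (cornerSums-top L₂ j≤n i≤n) (cong +_ (ℕP.*-comm j i))) ,
      trans (sym (cornerSums-rotate² E i j n)) (cornerSums-top L₃ i≤n j≤n)) ,
    (λ i j k i≤n j≤n 1≤k k≤n →
      subst (InRange n i j) (Δ₁-cong (cornerSums-rotate E) k i j)
        (cornerSums-Δ₁-InRange L₂ L₃ i≤n j≤n 1≤k k≤n) ,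
      InRange-comm {n} (subst (InRange n j i) (Δ₁-cong (cornerSums-rotate² E) k j i)
        (cornerSums-Δ₁-InRange L₃ L₁ j≤n i≤n 1≤k k≤n)) ,
      cornerSums-Δ₁-InRange L₁ L₂ i≤n j≤n 1≤k k≤n)

  ASLines⇒MixedDiffs01 : ASLines n E → MixedDiffs01 n C
  ASLines⇒MixedDiffs01 (L₁ , L₂ , L₃) i j k 1≤i i≤n 1≤j j≤n 1≤k k≤n =
    cornerSums-Δ₁₂-01 L₁ 1≤i i≤n 1≤j j≤n k≤n ,
    subst ZeroOne (trans (Δ₁₂-cong (cornerSums-rotate E) k i j) (Δ₁₂-rotate C i j k))
      (cornerSums-Δ₁₂-01 L₂ 1≤k k≤n 1≤i i≤n j≤n) ,
    subst ZeroOne (Δ₁₂-cong (cornerSums-rotate² E) j k i)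
      (cornerSums-Δ₁₂-01 L₃ 1≤j j≤n 1≤k k≤n i≤n)

  IsCornerSum×MixedDiffs01⇒ASLines : IsCornerSum n C × MixedDiffs01 n C → ASLines n E
  IsCornerSum×MixedDiffs01⇒ASLines ((boundary , _) , mixed01) =
    Lines-from-cornerSums
      (λ i≤n j≤n → proj₁ (tops i≤n j≤n))
      (λ 1≤i i≤n 1≤j j≤n 1≤k k≤n → proj₁ (mixed01 _ _ _ 1≤i i≤n 1≤j j≤n 1≤k k≤n)) ,
    Lines-from-cornerSums
      (λ {i} {j} i≤n j≤n → trans (cornerSums-rotate E i j n)
        (trans (proj₁ (proj₂ (tops j≤n i≤n))) (cong +_ (ℕP.*-comm j i))))
      (λ {i} {j} {k} 1≤i i≤n 1≤j j≤n 1≤k k≤n →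
        subst ZeroOne (sym (trans (Δ₁₂-cong (cornerSums-rotate E) i j k) (Δ₁₂-rotate C j k i)))
          (proj₁ (proj₂ (mixed01 j k i 1≤j j≤n 1≤k k≤n 1≤i i≤n)))) ,
    Lines-from-cornerSums
      (λ {i} {j} i≤n j≤n → trans (cornerSums-rotate² E i j n) (proj₂ (proj₂ (tops i≤n j≤n))))
      (λ {i} {j} {k} 1≤i i≤n 1≤j j≤n 1≤k k≤n →
        subst ZeroOne (sym (Δ₁₂-cong (cornerSums-rotate² E) i j k))
          (proj₂ (proj₂ (mixed01 k i j 1≤k k≤n 1≤i i≤n 1≤j j≤n))))
    where
    tops : ∀ {i j} → i ≤ n → j ≤ n →
      (C i j n ≡ + (i ℕ.* j)) × (C i n j ≡ + (i ℕ.* j)) × (C n i j ≡ + (i ℕ.* j))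
    tops i≤n j≤n = proj₂ (proj₂ (proj₂ (boundary _ _ i≤n j≤n)))

  ASLines⇔IsCornerSum×MixedDiffs01 : ASLines n E ⇔ (IsCornerSum n C × MixedDiffs01 n C)
  ASLines⇔IsCornerSum×MixedDiffs01 =
    mk⇔ (λ L → ASLines⇒IsCornerSum L , ASLines⇒MixedDiffs01 L) IsCornerSum×MixedDiffs01⇒ASLines

extend : ∀ {n} → Hypermatrix n → ℕ → ℕ → ℕ → ℤ
extend A a b c = at (λ z → at (λ y → at (λ x → A x y z) a) b) c

at-toℕ : ∀ {n} (f : Fin n → ℤ) (i : Fin n) → at f (suc (toℕ i)) ≡ f i
at-toℕ {n} f i with toℕ i ℕ.<? n
... | yes p = cong f (FinP.fromℕ<-toℕ i p)
... | no ¬p = contradiction (FinP.toℕ<n i) ¬p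

extend-toℕ : ∀ {n} (A : Hypermatrix n) a b c → extend A (suc (toℕ a)) (suc (toℕ b)) (suc (toℕ c)) ≡ A a b c
extend-toℕ A a b c = trans (at-toℕ _ c) (trans (at-toℕ _ b) (at-toℕ _ a))

IsASHM⇔ASLines : ∀ {n} (A : Hypermatrix n) → IsASHM n A ⇔ ASLines n (extend A)
IsASHM⇔ASLines {n} A = mk⇔
  (λ (_ , alongA , alongB , alongC) →
     Equivalence.from Lines⇔∀Fin (λ a b → lineTo (λ c → extend-toℕ A a b c) (alongC a b)) ,
     Equivalence.from Lines⇔∀Fin (λ c a → lineTo (λ b → extend-toℕ A a b c) (alongB a c)) ,
     Equivalence.from Lines⇔∀Fin (λ b c → lineTo (λ a → extend-toℕ A a b c) (alongA b c)))
  (λ (L₁ , L₂ , L₃) →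
     (λ a b c → subst Sign (extend-toℕ A a b c) (AltSigns-Sign (Equivalence.to Lines⇔∀Fin L₁ a b) c)) ,
     (λ b c → lineFrom (λ a → extend-toℕ A a b c) (Equivalence.to Lines⇔∀Fin L₃ b c)) ,
     (λ a c → lineFrom (λ b → extend-toℕ A a b c) (Equivalence.to Lines⇔∀Fin L₂ c a)) ,
     (λ a b → lineFrom (λ c → extend-toℕ A a b c) (Equivalence.to Lines⇔∀Fin L₁ a b)))
  where
  lineTo : ∀ {f : Fin n → ℤ} {h : ℕ → ℤ} → (∀ i → h (suc (toℕ i)) ≡ f i) → AltLine (tabulate f) → AltSigns n h
  lineTo agree = Equivalence.to (AltLine⇔AltSigns _ _ agree)
  lineFrom : ∀ {f : Fin n → ℤ} {h : ℕ → ℤ} → (∀ i → h (suc (toℕ i)) ≡ f i) → AltSigns n h → AltLine (tabulate f)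
  lineFrom agree = Equivalence.from (AltLine⇔AltSigns _ _ agree)

mainTheorem11 : (n : ℕ) (A : Hypermatrix n) →
    IsASHM n A ⇔
      (IsCornerSum n (Ξ A) ×
       (∀ i j k → 1 ≤ i → i ≤ n → 1 ≤ j → j ≤ n → 1 ≤ k → k ≤ n →
         ZeroOne (Ξ A i j k - Ξ A (i ∸ 1) j k - Ξ A i (j ∸ 1) k + Ξ A (i ∸ 1) (j ∸ 1) k) ×
         ZeroOne (Ξ A i j k - Ξ A (i ∸ 1) j k - Ξ A i j (k ∸ 1) + Ξ A (i ∸ 1) j (k ∸ 1)) ×
         ZeroOne (Ξ A i j k - Ξ A i (j ∸ 1) k - Ξ A i j (k ∸ 1) + Ξ A i (j ∸ 1) (k ∸ 1))))
mainTheorem11 n A = ⇔.trans (IsASHM⇔ASLines A) ASLines⇔IsCornerSum×MixedDiffs01
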